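{- Let $P$ be a finite interval order with key graph $G_P$, and let $\rho_w,\rho_x,\rho_y,\rho_z$ be distinct vertices of $G_P$. (I) If $\rho_w\to\rho_x$ and $\rho_w\to\rho_y$ are blue arcs and $\rho_x\to\rho_z$ is a red arc of $G_P$, then $\rho_y\to\rho_z$ is a red arc of $G_P$. (II) If $\rho_w\to\rho_x$ and $\rho_w\to\rho_y$ are red arcs and $\rho_x\to\rho_z$ is a blue arc of $G_P$, then $\rho_y\to\rho_z$ is a blue arc of $G_P$. (III) If $\rho_w\to\rho_x$, $\rho_w\to\rho_y$ and $\rho_z\to\rho_x$ are red arcs of $G_P$, then $\rho_z\to\rho_y$ is a red arc of $G_P$. (IV) If $\rho_w\to\rho_x$, $\rho_w\to\rho_y$ and $\rho_z\to\rho_x$ are blue arcs of $G_P$, then $\rho_z\to\rho_y$ is a blue arc of $G_P$.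
   Context: A finite partial order $P=([n],\prec)$ is an interval order if there are compact real intervals $I_x=[\ell_x,r_x]$ with $x\prec y$ iff $r_x<\ell_y$; write $x\parallel y$ if $x\ne y$ are incomparable. The canonical representation $[\ell_x,r_x]_{x\in[n]}$ of $P$ is the (unique) representation using the minimum number $m$ of distinct endpoints, placed at the integers $0,\dots,m-1$. For $y\not\prec x$, the slack of $(x,y)$ in the canonical representation is $\ell_y-r_x-1$ if $x\prec y$, $r_y-\ell_x$ if $x\parallel y$, $r_x-\ell_x$ if $x=y$; pairs with slack $0$ are slack zero pairs, called slack zero cover pairs if $x\prec y$ and slack zero sharp pairs if $x\parallel y$. The key graph $G_P$ is the directed graph on vertex set $\{\rho_1,\dots,\rho_n\}$ with a blue arc $\rho_x\to\rho_y$ for each slack zero cover pair $(x,y)$, a red arc $\rho_x\to\rho_y$ for each slack zero sharp pair $(x,y)$, and a red loop at $\rho_x$ for each slack zero pair $(x,x)$. -}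

module Defs where

open import Level using (0ℓ)
open import Data.Nat using (ℕ; suc; _≤_; _<_; _≟_)
open import Data.Fin using (Fin)
open import Data.List using (List; map; _++_; length; deduplicate)
open import Data.List.Base using (allFin)
open import Data.Product using (_×_; ∃)
open import Data.Sum using (_⊎_)
open import Relation.Nullary using (¬_)
open import Relation.Binary using (Rel)
open import Relation.Binary.PropositionalEquality using (_≡_; _≢_)

record IsIntervalRep {n : ℕ} (_≺_ : Rel (Fin n) 0ℓ) (ℓ r : Fin n → ℕ) : Set where
  field
    compact : ∀ x → ℓ x ≤ r x
    rep⇒    : ∀ x y → x ≺ y → r x < ℓ y
    rep⇐    : ∀ x y → r x < ℓ y → x ≺ y

IsIntervalOrder : {n : ℕ} → Rel (Fin n) 0ℓ → Set
IsIntervalOrder {n} _≺_ = ∃ λ (ℓ : Fin n → ℕ) → ∃ λ (r : Fin n → ℕ) → IsIntervalRep _≺_ ℓ r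

endpointCount : {n : ℕ} → (Fin n → ℕ) → (Fin n → ℕ) → ℕ
endpointCount {n} ℓ r = length (deduplicate _≟_ (map ℓ (allFin n) ++ map r (allFin n)))

IsEndpoint : {n : ℕ} → (Fin n → ℕ) → (Fin n → ℕ) → ℕ → Set
IsEndpoint ℓ r k = ∃ λ x → (ℓ x ≡ k ⊎ r x ≡ k)

record IsCanonicalRep {n : ℕ} (_≺_ : Rel (Fin n) 0ℓ) (ℓ r : Fin n → ℕ) : Set₁ where
  field
    isRep     : IsIntervalRep _≺_ ℓ r
    minimal   : ∀ (ℓ' r' : Fin n → ℕ) → IsIntervalRep _≺_ ℓ' r' →
                endpointCount ℓ r ≤ endpointCount ℓ' r'
    endpoints : ∀ k → IsEndpoint ℓ r k → k < endpointCount ℓ r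
    initial   : ∀ k → k < endpointCount ℓ r → IsEndpoint ℓ r k

module KeyGraph {n : ℕ} (_≺_ : Rel (Fin n) 0ℓ) (ℓ r : Fin n → ℕ) where

  _∥_ : Rel (Fin n) 0ℓ
  x ∥ y = x ≢ y × ¬ (x ≺ y) × ¬ (y ≺ x)

  -- blue arc ρx → ρy : slack zero cover pair (x ≺ y and ℓ y - r x - 1 = 0)
  BlueArc : Rel (Fin n) 0ℓ
  BlueArc x y = x ≺ y × ℓ y ≡ suc (r x)

  -- red arc ρx → ρy (or red loop when x = y): slack zero sharp pair
  -- (x ∥ y and r y - ℓ x = 0), or slack zero pair (x , x) (r x - ℓ x = 0)
  RedArc : Rel (Fin n) 0ℓ
  RedArc x y = (x ≡ y ⊎ x ∥ y) × r y ≡ ℓ x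

{-# OPTIONS --safe #-}
-- A blue arc a → b is the endpoint equation ℓ b = r a + 1, and between distinct
-- elements a red arc a → b is the equation r b = ℓ a, since touching intervals are
-- incomparable. Each of the four closure rules is then a chase of endpoint
-- equations, valid in every interval representation, canonical or not.
module Submission where

open import Defs
open import Level using (0ℓ)
open import Data.Nat using (ℕ; suc)
open import Data.Nat.Properties using (<-irrefl; ≤-reflexive; module ≤-Reasoning)
open import Data.Fin using (Fin)
open import Data.Product using (_×_; _,_)
open import Data.Sum using (inj₂)
open import Relation.Nullary using (¬_)
open import Relation.Binary using (Rel)
open import Relation.Binary.PropositionalEquality using (_≡_; _≢_; refl; sym; trans; cong)

module KeyGraphProperties {n : ℕ} {_≺_ : Rel (Fin n) 0ℓ} {ℓ r : Fin n → ℕ}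
                          (rep : IsIntervalRep _≺_ ℓ r) where

  open IsIntervalRep rep
  open KeyGraph _≺_ ℓ r

  touching⇒∥ : ∀ {a b} → a ≢ b → r b ≡ ℓ a → a ∥ b
  touching⇒∥ {a} {b} a≢b rb≡ℓa = a≢b , a⊀b , (λ b≺a → <-irrefl rb≡ℓa (rep⇒ b a b≺a))
    where
    open ≤-Reasoning
    a⊀b : ¬ (a ≺ b)
    a⊀b a≺b = <-irrefl refl (begin-strict
      r a  <⟨ rep⇒ a b a≺b ⟩
      ℓ b  ≤⟨ compact b ⟩
      r b  ≡⟨ rb≡ℓa ⟩
      ℓ a  ≤⟨ compact a ⟩
      r a  ∎)

  touching⇒redArc : ∀ {a b} → a ≢ b → r b ≡ ℓ a → RedArc a b
  touching⇒redArc a≢b rb≡ℓa = inj₂ (touching⇒∥ a≢b rb≡ℓa) , rb≡ℓa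

  adjacent⇒blueArc : ∀ {a b} → ℓ b ≡ suc (r a) → BlueArc a b
  adjacent⇒blueArc {a} {b} ℓb≡1+ra = rep⇐ a b (≤-reflexive (sym ℓb≡1+ra)) , ℓb≡1+ra

  blue-blue-red⇒red : ∀ {w x y z} → y ≢ z →
                      BlueArc w x → BlueArc w y → RedArc x z → RedArc y z
  blue-blue-red⇒red y≢z (_ , ℓx≡1+rw) (_ , ℓy≡1+rw) (_ , rz≡ℓx) =
    touching⇒redArc y≢z (trans rz≡ℓx (trans ℓx≡1+rw (sym ℓy≡1+rw)))

  red-red-blue⇒blue : ∀ {w x y z} →
                      RedArc w x → RedArc w y → BlueArc x z → BlueArc y z
  red-red-blue⇒blue (_ , rx≡ℓw) (_ , ry≡ℓw) (_ , ℓz≡1+rx) =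
    adjacent⇒blueArc (trans ℓz≡1+rx (cong suc (trans rx≡ℓw (sym ry≡ℓw))))

  red-red-red⇒red : ∀ {w x y z} → z ≢ y →
                    RedArc w x → RedArc w y → RedArc z x → RedArc z y
  red-red-red⇒red z≢y (_ , rx≡ℓw) (_ , ry≡ℓw) (_ , rx≡ℓz) =
    touching⇒redArc z≢y (trans ry≡ℓw (trans (sym rx≡ℓw) rx≡ℓz))

  blue-blue-blue⇒blue : ∀ {w x y z} →
                        BlueArc w x → BlueArc w y → BlueArc z x → BlueArc z y
  blue-blue-blue⇒blue (_ , ℓx≡1+rw) (_ , ℓy≡1+rw) (_ , ℓx≡1+rz) =
    adjacent⇒blueArc (trans ℓy≡1+rw (trans (sym ℓx≡1+rw) ℓx≡1+rz))

lemma4p1 : (n : ℕ) (_≺_ : Rel (Fin n) 0ℓ) (ℓ r : Fin n → ℕ) →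
    IsCanonicalRep _≺_ ℓ r →
    (w x y z : Fin n) →
    w ≢ x → w ≢ y → w ≢ z → x ≢ y → x ≢ z → y ≢ z →
    ((KeyGraph.BlueArc _≺_ ℓ r w x → KeyGraph.BlueArc _≺_ ℓ r w y → KeyGraph.RedArc _≺_ ℓ r x z → KeyGraph.RedArc _≺_ ℓ r y z)
    × (KeyGraph.RedArc _≺_ ℓ r w x → KeyGraph.RedArc _≺_ ℓ r w y → KeyGraph.BlueArc _≺_ ℓ r x z → KeyGraph.BlueArc _≺_ ℓ r y z)
    × (KeyGraph.RedArc _≺_ ℓ r w x → KeyGraph.RedArc _≺_ ℓ r w y → KeyGraph.RedArc _≺_ ℓ r z x → KeyGraph.RedArc _≺_ ℓ r z y)
    × (KeyGraph.BlueArc _≺_ ℓ r w x → KeyGraph.BlueArc _≺_ ℓ r w y → KeyGraph.BlueArc _≺_ ℓ r z x → KeyGraph.BlueArc _≺_ ℓ r z y))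
lemma4p1 n _≺_ ℓ r can w x y z _ _ _ _ _ y≢z =
    blue-blue-red⇒red y≢z
  , red-red-blue⇒blue
  , red-red-red⇒red (λ z≡y → y≢z (sym z≡y))
  , blue-blue-blue⇒blue
  where open KeyGraphProperties (IsCanonicalRep.isRep can)
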